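{- Let $T$ be a finite Church-Rosser Thue system over $\Sigma$ and let $u_1,\dots,u_n$ be strings, irreducible modulo $T$, lying in $L$, such that $L=[u_1]_T\cup\dots\cup[u_n]_T$. If $x\to_T y$, then $|x|_{\mathrm{pos}}>|y|_{\mathrm{pos}}$ and $|x|_{\mathrm{neg}}>|y|_{\mathrm{neg}}$.
   Context: $\Sigma=\{a,b,\overline{a},\overline{b}\}$; $a,b$ are positive letters and $\overline{a},\overline{b}$ negative letters; $|x|_{\mathrm{pos}}$ and $|x|_{\mathrm{neg}}$ denote the numbers of occurrences of positive, respectively negative, letters in $x$. $\lambda$ is the empty string. $S$ is the Thue system with rules $(a\overline{a},\lambda),(\overline{a}a,\lambda),(a\overline{b},\lambda),(\overline{b}a,\lambda),(b\overline{a},\lambda),(\overline{a}b,\lambda),(b\overline{b},\lambda),(\overline{b}b,\lambda),(a,b),(b,a),(\overline{a},\overline{b}),(\overline{b},\overline{a})$, and $L=[\lambda]_S$, the set of strings with equally many positive as negative letters. For a Thue system $T$ (pairs $(u,w)$ with $|u|\ge|w|$): $x\leftrightarrow_T y$ if $x=tuv$, $y=twv$ with $(u,w)$ or $(w,u)\in T$; $\overset{*}{\leftrightarrow}_T$ its reflexive-transitive closure; $[x]_T$ the class of $x$; $x\to_T y$ means $x\leftrightarrow_T y$ with $|x|>|y|$; a string is irreducible modulo $T$ if no $\to_T$ step applies to it. $T$ is Church-Rosser if $x\overset{*}{\leftrightarrow}_T y$ implies a common $z$ with $x\overset{*}{\to}_T z$, $y\overset{*}{\to}_T z$. -}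

module Defs where

open import Data.Nat using (ℕ; zero; suc; _≤_; _>_; _+_)
open import Data.List using (List; []; _∷_; _++_; length)
open import Data.List.Membership.Propositional using (_∈_)
open import Data.List.Relation.Unary.All using (All)
open import Data.Product using (_×_; _,_; ∃; proj₁; proj₂)
open import Data.Sum using (_⊎_)
open import Data.Empty using (⊥)
open import Relation.Binary.PropositionalEquality using (_≡_)
open import Relation.Binary.Construct.Closure.ReflexiveTransitive using (Star)

data Sym : Set where
  a b a̅ b̅ : Sym

Str : Set
Str = List Sym

λ-str : Str
λ-str = []

isPos : Sym → ℕ
isPos a = 1
isPos b = 1
isPos a̅ = 0
isPos b̅ = 0

isNeg : Sym → ℕ
isNeg a = 0
isNeg b = 0
isNeg a̅ = 1
isNeg b̅ = 1

∣_∣pos : Str → ℕ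
∣ [] ∣pos = 0
∣ c ∷ x ∣pos = isPos c + ∣ x ∣pos

∣_∣neg : Str → ℕ
∣ [] ∣neg = 0
∣ c ∷ x ∣neg = isNeg c + ∣ x ∣neg

ThueSystem : Set
ThueSystem = List (Str × Str)

LengthOrdered : ThueSystem → Set
LengthOrdered T = All (λ r → length (proj₂ r) ≤ length (proj₁ r)) T

data _⊢_↔_ (T : ThueSystem) : Str → Str → Set where
  step : ∀ t u w v → ((u , w) ∈ T ⊎ (w , u) ∈ T) →
         T ⊢ (t ++ u ++ v) ↔ (t ++ w ++ v)

_⊢_↔*_ : ThueSystem → Str → Str → Set
T ⊢ x ↔* y = Star (T ⊢_↔_) x y

_∈[_]_ : Str → Str → ThueSystem → Set
y ∈[ x ] T = T ⊢ x ↔* y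

_⊢_⟶_ : ThueSystem → Str → Str → Set
T ⊢ x ⟶ y = (T ⊢ x ↔ y) × (length x > length y)

_⊢_⟶*_ : ThueSystem → Str → Str → Set
T ⊢ x ⟶* y = Star (T ⊢_⟶_) x y

Irreducible : ThueSystem → Str → Set
Irreducible T x = ∀ y → T ⊢ x ⟶ y → ⊥

ChurchRosser : ThueSystem → Set
ChurchRosser T = ∀ x y → T ⊢ x ↔* y → ∃ λ z → (T ⊢ x ⟶* z) × (T ⊢ y ⟶* z)

S : ThueSystem
S = (a ∷ a̅ ∷ [] , []) ∷ (a̅ ∷ a ∷ [] , []) ∷ (a ∷ b̅ ∷ [] , []) ∷ (b̅ ∷ a ∷ [] , [])
  ∷ (b ∷ a̅ ∷ [] , []) ∷ (a̅ ∷ b ∷ [] , []) ∷ (b ∷ b̅ ∷ [] , []) ∷ (b̅ ∷ b ∷ [] , [])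
  ∷ (a ∷ [] , b ∷ []) ∷ (b ∷ [] , a ∷ []) ∷ (a̅ ∷ [] , b̅ ∷ []) ∷ (b̅ ∷ [] , a̅ ∷ []) ∷ []

L : Str → Set
L x = x ∈[ λ-str ] S

-- If (p , q) is a rule of T, then p followed by its formal inverse p⁻¹ lies in L; rewriting p to q
-- stays inside the T-class of some uᵢ, hence inside L, so q p⁻¹ is balanced too.  Thus every rule
-- preserves the balance |·|pos − |·|neg, and a rule that also shortens the string must then lose
-- both positive and negative letters.
module Submission where

open import Defs
open import Data.Nat using (ℕ; _>_; _+_; _<_; _≤_)
open import Data.Nat.Properties
  using (+-assoc; +-comm; +-suc; +-cancelˡ-≤; +-cancelˡ-<; +-cancelʳ-<; +-monoˡ-≤; +-monoˡ-<; +-monoʳ-<;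
         +-mono-≤; <⇒≱; ≰⇒>)
open import Data.Integer as ℤ using (ℤ; +_)
open import Data.Integer.Properties using (pos-+; +-injective)
open import Data.Integer.Tactic.RingSolver using (solve-∀)
open import Data.Fin using (Fin)
open import Data.List using ([]; _∷_; _++_; [_]; length)
open import Data.List.Properties using (++-assoc; length-++)
open import Data.List.Membership.Propositional using (_∈_)
open import Data.List.Relation.Unary.All using (All; []; _∷_; lookup)
open import Data.List.Relation.Unary.Any using (here; there)
open import Data.Product using (_×_; _,_; ∃; proj₁; proj₂)
open import Data.Sum using (_⊎_; inj₁; inj₂)
open import Function.Bundles using (_⇔_; Equivalence)
open import Relation.Binary.PropositionalEquality using (_≡_; refl; sym; trans; cong; cong₂; subst; subst₂; module ≡-Reasoning)
open import Relation.Binary.Construct.Closure.ReflexiveTransitive using (ε; _◅_; _◅◅_; gmap)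

open ≡-Reasoning

Rule : ThueSystem → Str → Str → Set
Rule T u w = (u , w) ∈ T ⊎ (w , u) ∈ T

↔-inContext : ∀ {T x y} t v → T ⊢ x ↔ y → T ⊢ t ++ x ++ v ↔ (t ++ y ++ v)
↔-inContext {T} t v (step t′ u w v′ r) =
  subst₂ (λ x′ y′ → T ⊢ x′ ↔ y′) (regroup u) (regroup w) (step (t ++ t′) u w (v′ ++ v) r)
  where
    regroup : ∀ m → (t ++ t′) ++ m ++ v′ ++ v ≡ t ++ (t′ ++ m ++ v′) ++ v
    regroup m = begin
      (t ++ t′) ++ m ++ v′ ++ v   ≡⟨ ++-assoc t t′ _ ⟩
      t ++ t′ ++ m ++ v′ ++ v     ≡⟨ cong (λ s → t ++ t′ ++ s) (++-assoc m v′ v) ⟨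
      t ++ t′ ++ (m ++ v′) ++ v   ≡⟨ cong (t ++_) (++-assoc t′ (m ++ v′) v) ⟨
      t ++ (t′ ++ m ++ v′) ++ v   ∎

↔*-inContext : ∀ {T x y} t v → T ⊢ x ↔* y → T ⊢ t ++ x ++ v ↔* (t ++ y ++ v)
↔*-inContext t v = gmap (λ x → t ++ x ++ v) (↔-inContext t v)

Additive : (Str → ℕ) → Set
Additive f = ∀ x y → f (x ++ y) ≡ f x + f y

pos-++ : Additive ∣_∣pos
pos-++ []      y = refl
pos-++ (c ∷ x) y = trans (cong (_+_ (isPos c)) (pos-++ x y)) (sym (+-assoc (isPos c) _ _))

neg-++ : Additive ∣_∣neg
neg-++ []      y = refl
neg-++ (c ∷ x) y = trans (cong (_+_ (isNeg c)) (neg-++ x y)) (sym (+-assoc (isNeg c) _ _))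

length-additive : Additive length
length-additive x y = length-++ x

length≡pos+neg : ∀ x → length x ≡ ∣ x ∣pos + ∣ x ∣neg
length≡pos+neg []      = refl
length≡pos+neg (a ∷ x) = cong ℕ.suc (length≡pos+neg x)
length≡pos+neg (b ∷ x) = cong ℕ.suc (length≡pos+neg x)
length≡pos+neg (a̅ ∷ x) = trans (cong ℕ.suc (length≡pos+neg x)) (sym (+-suc ∣ x ∣pos ∣ x ∣neg))
length≡pos+neg (b̅ ∷ x) = trans (cong ℕ.suc (length≡pos+neg x)) (sym (+-suc ∣ x ∣pos ∣ x ∣neg))

module _ (f : Str → ℕ) (f-++ : Additive f) (t x y v : Str) where

  private
    inContext : ∀ m → f (t ++ m ++ v) ≡ f t + (f m + f v)
    inContext m = trans (f-++ t (m ++ v)) (cong (_+_ (f t)) (f-++ m v))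

  additive-<-inContext : f x < f y → f (t ++ x ++ v) < f (t ++ y ++ v)
  additive-<-inContext fx<fy =
    subst₂ _<_ (sym (inContext x)) (sym (inContext y)) (+-monoʳ-< (f t) (+-monoˡ-< (f v) fx<fy))

  additive-<-fromContext : f (t ++ x ++ v) < f (t ++ y ++ v) → f x < f y
  additive-<-fromContext lt =
    +-cancelʳ-< (f v) (f x) (f y) (+-cancelˡ-< (f t) _ _ (subst₂ _<_ (inContext x) (inContext y) lt))

balance : Str → ℤ
balance x = + ∣ x ∣pos ℤ.- + ∣ x ∣neg

balance-++ : ∀ x y → balance (x ++ y) ≡ balance x ℤ.+ balance y
balance-++ x y = begin
  + ∣ x ++ y ∣pos ℤ.- + ∣ x ++ y ∣neg
    ≡⟨ cong₂ (λ p n → + p ℤ.- + n) (pos-++ x y) (neg-++ x y) ⟩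
  + (∣ x ∣pos + ∣ y ∣pos) ℤ.- + (∣ x ∣neg + ∣ y ∣neg)
    ≡⟨ cong₂ ℤ._-_ (pos-+ ∣ x ∣pos ∣ y ∣pos) (pos-+ ∣ x ∣neg ∣ y ∣neg) ⟩
  (+ ∣ x ∣pos ℤ.+ + ∣ y ∣pos) ℤ.- (+ ∣ x ∣neg ℤ.+ + ∣ y ∣neg)
    ≡⟨ interchange (+ ∣ x ∣pos) (+ ∣ y ∣pos) (+ ∣ x ∣neg) (+ ∣ y ∣neg) ⟩
  balance x ℤ.+ balance y ∎
  where
    interchange : ∀ p q m n → (p ℤ.+ q) ℤ.- (m ℤ.+ n) ≡ (p ℤ.- m) ℤ.+ (q ℤ.- n)
    interchange = solve-∀

balance-cancelʳ : ∀ x y z → balance (x ++ z) ≡ balance (y ++ z) → balance x ≡ balance y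
balance-cancelʳ x y z eq = begin
  balance x                                     ≡⟨ addSub (balance x) (balance z) ⟩
  (balance x ℤ.+ balance z) ℤ.- balance z       ≡⟨ cong (ℤ._- balance z) (trans (sym (balance-++ x z)) eq) ⟩
  balance (y ++ z) ℤ.- balance z                ≡⟨ cong (ℤ._- balance z) (balance-++ y z) ⟩
  (balance y ℤ.+ balance z) ℤ.- balance z       ≡⟨ addSub (balance y) (balance z) ⟨
  balance y                                     ∎
  where
    addSub : ∀ i j → i ≡ (i ℤ.+ j) ℤ.- j
    addSub = solve-∀

balance≡⇒pos+neg≡ : ∀ x y → balance x ≡ balance y → ∣ x ∣pos + ∣ y ∣neg ≡ ∣ y ∣pos + ∣ x ∣neg
balance≡⇒pos+neg≡ x y eq = +-injective (begin
  + (∣ x ∣pos + ∣ y ∣neg)            ≡⟨ pos-+ ∣ x ∣pos ∣ y ∣neg ⟩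
  + ∣ x ∣pos ℤ.+ + ∣ y ∣neg          ≡⟨ shift (+ ∣ x ∣pos) (+ ∣ x ∣neg) (+ ∣ y ∣neg) ⟩
  balance x ℤ.+ (+ ∣ x ∣neg ℤ.+ + ∣ y ∣neg)   ≡⟨ cong (ℤ._+ (+ ∣ x ∣neg ℤ.+ + ∣ y ∣neg)) eq ⟩
  balance y ℤ.+ (+ ∣ x ∣neg ℤ.+ + ∣ y ∣neg)   ≡⟨ shift′ (+ ∣ y ∣pos) (+ ∣ y ∣neg) (+ ∣ x ∣neg) ⟨
  + ∣ y ∣pos ℤ.+ + ∣ x ∣neg          ≡⟨ pos-+ ∣ y ∣pos ∣ x ∣neg ⟨
  + (∣ y ∣pos + ∣ x ∣neg)            ∎)
  where
    shift : ∀ p m n → p ℤ.+ n ≡ (p ℤ.- m) ℤ.+ (m ℤ.+ n)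
    shift = solve-∀
    shift′ : ∀ p n m → p ℤ.+ m ≡ (p ℤ.- n) ℤ.+ (m ℤ.+ n)
    shift′ = solve-∀

BalancePreserving : ThueSystem → Set
BalancePreserving T = All (λ r → balance (proj₁ r) ≡ balance (proj₂ r)) T

balance-↔ : ∀ {T x y} → BalancePreserving T → T ⊢ x ↔ y → balance x ≡ balance y
balance-↔ {T} preserving (step t u w v r) = begin
  balance (t ++ u ++ v)                         ≡⟨ inContext u ⟩
  balance t ℤ.+ (balance u ℤ.+ balance v)       ≡⟨ cong (λ i → balance t ℤ.+ (i ℤ.+ balance v)) (rule r) ⟩
  balance t ℤ.+ (balance w ℤ.+ balance v)       ≡⟨ inContext w ⟨
  balance (t ++ w ++ v)                         ∎
  where
    inContext : ∀ m → balance (t ++ m ++ v) ≡ balance t ℤ.+ (balance m ℤ.+ balance v)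
    inContext m = trans (balance-++ t (m ++ v)) (cong (ℤ._+_ (balance t)) (balance-++ m v))
    rule : ∀ {u w} → Rule T u w → balance u ≡ balance w
    rule (inj₁ uw∈T) = lookup preserving uw∈T
    rule (inj₂ wu∈T) = sym (lookup preserving wu∈T)

balance-↔* : ∀ {T x y} → BalancePreserving T → T ⊢ x ↔* y → balance x ≡ balance y
balance-↔* preserving ε        = refl
balance-↔* preserving (s ◅ ss) = trans (balance-↔ preserving s) (balance-↔* preserving ss)

S-balancePreserving : BalancePreserving S
S-balancePreserving = refl ∷ refl ∷ refl ∷ refl ∷ refl ∷ refl ∷ refl ∷ refl ∷ refl ∷ refl ∷ refl ∷ refl ∷ []

L⇒balance≡0 : ∀ {x} → L x → balance x ≡ + 0
L⇒balance≡0 x∈L = sym (balance-↔* S-balancePreserving x∈L)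

invSym : Sym → Sym
invSym a = a̅
invSym b = b̅
invSym a̅ = a
invSym b̅ = b

inverse : Str → Str
inverse []      = []
inverse (c ∷ x) = inverse x ++ [ invSym c ]

cancelPair∈S : ∀ c → (c ∷ invSym c ∷ [] , []) ∈ S
cancelPair∈S a = here refl
cancelPair∈S a̅ = there (here refl)
cancelPair∈S b = there (there (there (there (there (there (here refl))))))
cancelPair∈S b̅ = there (there (there (there (there (there (there (here refl)))))))

++-inverse∈L : ∀ x → L (x ++ inverse x)
++-inverse∈L []      = ε
++-inverse∈L (c ∷ x) =
  step [] [] (c ∷ invSym c ∷ []) [] (inj₂ (cancelPair∈S c))
    ◅ subst (λ z → S ⊢ c ∷ invSym c ∷ [] ↔* z)
            (cong (c ∷_) (++-assoc x (inverse x) [ invSym c ]))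
            (↔*-inContext [ c ] [ invSym c ] (++-inverse∈L x))

L-closedUnder : ThueSystem → Set
L-closedUnder T = ∀ {x y} → T ⊢ x ↔ y → L x → L y

unionOfClasses⇒L-closed : ∀ {I : Set} {T} (u : I → Str) →
  (∀ x → L x ⇔ ∃ λ i → x ∈[ u i ] T) → L-closedUnder T
unionOfClasses⇒L-closed u L⇔⋃ {x} {y} x↔y x∈L =
  let i , ui↔*x = Equivalence.to (L⇔⋃ x) x∈L
  in Equivalence.from (L⇔⋃ y) (i , ui↔*x ◅◅ (x↔y ◅ ε))

rule-preserves-balance : ∀ {T p q} → L-closedUnder T → Rule T p q → balance p ≡ balance q
rule-preserves-balance {p = p} {q} closed r =
  balance-cancelʳ p q (inverse p)
    (trans (L⇒balance≡0 p⁻p∈L) (sym (L⇒balance≡0 (closed (step [] p q (inverse p) r) p⁻p∈L))))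
  where
    p⁻p∈L : L (p ++ inverse p)
    p⁻p∈L = ++-inverse∈L p

cross≡∧sum<⇒< : ∀ {p n p′ n′} → p + n′ ≡ p′ + n → p′ + n′ < p + n → p′ < p
cross≡∧sum<⇒< {p} {n} {p′} {n′} cross sum< = ≰⇒> λ p≤p′ →
  <⇒≱ sum< (+-mono-≤ p≤p′ (+-cancelˡ-≤ p n n′ (subst (p + n ≤_) (sym cross) (+-monoˡ-≤ n p≤p′))))

balanced-shorter⇒pos<∧neg< : ∀ x y → balance x ≡ balance y → length y < length x →
  ∣ y ∣pos < ∣ x ∣pos × ∣ y ∣neg < ∣ x ∣neg
balanced-shorter⇒pos<∧neg< x y eq shorter =
    cross≡∧sum<⇒< cross sum<
  , cross≡∧sum<⇒< (trans (+-comm ∣ x ∣neg _) (trans (sym cross) (+-comm ∣ x ∣pos _)))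
                  (subst₂ _<_ (+-comm ∣ y ∣pos _) (+-comm ∣ x ∣pos _) sum<)
  where
    cross = balance≡⇒pos+neg≡ x y eq
    sum< : ∣ y ∣pos + ∣ y ∣neg < ∣ x ∣pos + ∣ x ∣neg
    sum< = subst₂ _<_ (length≡pos+neg y) (length≡pos+neg x) shorter

mainTheorem8 : (T : ThueSystem) → LengthOrdered T → ChurchRosser T →
    (n : ℕ) (u : Fin n → Str) →
    (∀ i → Irreducible T (u i)) → (∀ i → L (u i)) →
    (∀ x → L x ⇔ ∃ λ i → x ∈[ u i ] T) →
    ∀ x y → T ⊢ x ⟶ y → (∣ x ∣pos > ∣ y ∣pos) × (∣ x ∣neg > ∣ y ∣neg)
mainTheorem8 T _ _ _ u _ _ L⇔⋃ .(t ++ p ++ v) .(t ++ q ++ v) (step t p q v r , shorter) =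
  let balanced = rule-preserves-balance (unionOfClasses⇒L-closed u L⇔⋃) r
      q<p      = additive-<-fromContext length length-additive t q p v shorter
      pos< , neg< = balanced-shorter⇒pos<∧neg< p q balanced q<p
  in additive-<-inContext ∣_∣pos pos-++ t q p v pos< , additive-<-inContext ∣_∣neg neg-++ t q p v neg<
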